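{- Let $q,k$ be positive integers. If $G$ is a $(q,2k)$-unbreakable graph that contains an induced odd cycle of length at least $2q+2$, then $G$ has a minimal oct of size at least $k$.
   Context: All graphs are finite, simple and undirected. An oct of $G$ is a set $Z\subseteq V(G)$ with $G-Z$ bipartite; it is minimal if no proper subset is an oct. An induced odd cycle is an odd-length cycle whose vertex set induces exactly that cycle. A separation of $G$ is a pair $(X,Y)$ with $X\cup Y=V(G)$ and no edge between $X\setminus Y$ and $Y\setminus X$; its order is $|X\cap Y|$. $G$ is $(q,c)$-unbreakable if there is no separation of order at most $c$ with $|X\setminus Y|\geq q$ and $|Y\setminus X|\geq q$. -}

module Defs where

open import Data.Nat using (ℕ; zero; suc; _≤_)
open import Data.Nat.Properties using ()
open import Data.Bool using (Bool; true; false)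
open import Data.Fin using (Fin; toℕ)
open import Data.Fin.Subset using (Subset; _∈_; _∉_; _⊂_; _∩_; _∪_; _─_; ∣_∣)
open import Data.Product using (Σ; ∃; _×_; _,_)
open import Data.Sum using (_⊎_)
open import Data.Empty using (⊥)
open import Relation.Nullary using (¬_)
open import Relation.Binary.PropositionalEquality using (_≡_; _≢_)
open import Function.Definitions using (Injective)
open import Function.Bundles using (_⇔_)

record Graph (n : ℕ) : Set where
  field
    adj     : Fin n → Fin n → Bool
    adj-sym : ∀ u v → adj u v ≡ adj v u
    adj-irr : ∀ v → adj v v ≡ false

open Graph public

Edge : ∀ {n} → Graph n → Fin n → Fin n → Set
Edge G u v = adj G u v ≡ true

IsOCT : ∀ {n} → Graph n → Subset n → Set
IsOCT {n} G Z = Σ (Fin n → Bool) λ c →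
  ∀ u v → u ∉ Z → v ∉ Z → Edge G u v → c u ≢ c v

IsMinimalOCT : ∀ {n} → Graph n → Subset n → Set
IsMinimalOCT G Z = IsOCT G Z × (∀ Z′ → Z′ ⊂ Z → ¬ IsOCT G Z′)

CycNext : ∀ {L} → Fin L → Fin L → Set
CycNext {L} i j = (suc (toℕ i) ≡ toℕ j) ⊎ ((suc (toℕ i) ≡ L) × (toℕ j ≡ 0))

CycAdj : ∀ {L} → Fin L → Fin L → Set
CycAdj i j = CycNext i j ⊎ CycNext j i

Odd : ℕ → Set
Odd m = ∃ λ t → m ≡ suc (t Data.Nat.+ t)

InducedCycle : ∀ {n} → Graph n → (L : ℕ) → Set
InducedCycle {n} G L = 3 ≤ L × Σ (Fin L → Fin n) λ f →
  Injective _≡_ _≡_ f × (∀ i j → Edge G (f i) (f j) ⇔ CycAdj i j)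

InducedOddCycle : ∀ {n} → Graph n → ℕ → Set
InducedOddCycle G L = Odd L × InducedCycle G L

IsSeparation : ∀ {n} → Graph n → Subset n → Subset n → Set
IsSeparation {n} G X Y =
  (∀ v → v ∈ X ⊎ v ∈ Y) ×
  (∀ u v → u ∈ (X ─ Y) → v ∈ (Y ─ X) → ¬ Edge G u v)

order : ∀ {n} → Subset n → Subset n → ℕ
order X Y = ∣ X ∩ Y ∣

Unbreakable : ∀ {n} → ℕ → ℕ → Graph n → Set
Unbreakable q c G = ∀ X Y → IsSeparation G X Y → order X Y ≤ c →
  q ≤ ∣ X ─ Y ∣ → q ≤ ∣ Y ─ X ∣ → ⊥

{-# OPTIONS --safe #-}

-- Let C = f 0, …, f (L-1) be the induced odd cycle and r = q + 1. Deleting f 0, resp. f r, from C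
-- leaves an induced path, so some minimal oct Z₁, resp. Z₂, meets C only in f 0, resp. f r. Suppose
-- both have fewer than k vertices and let c₁, c₂ be proper 2-colourings of G - Z₁ and G - Z₂. Both
-- change along every edge of G - (Z₁ ∪ Z₂), so c₁ xor c₂ is constant there, and its two level sets,
-- each together with Z₁ ∪ Z₂, form a separation of order less than 2k. Walking f 1, …, f (r+1)
-- changes c₁ r times and walking on from f (r+1) around to f 1 changes c₂ L - r times; as L is odd,
-- c₁ xor c₂ differs at f 1 and f (r+1). So the arcs f 1, …, f q and f (q+2), …, f (2q+1) lie on
-- opposite sides, contradicting (q, 2k)-unbreakability.

module Submission where

open import Defs
open import Algebra.Bundles using (CommutativeRing)
open import Data.Bool using (Bool; true; false; not; _xor_)
import Data.Bool as B
open import Data.Bool.Properties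
  using (not-¬; ¬-not; not-distribˡ-xor; xor-same; xor-comm; xor-annihilates-not; xor-∧-commutativeRing)
open import Algebra.Properties.CommutativeSemigroup
  (CommutativeRing.+-commutativeSemigroup xor-∧-commutativeRing)
  using () renaming (interchange to xor-interchange)
open import Data.Empty using (⊥-elim)
open import Data.Fin as F using (Fin; toℕ; fromℕ<)
open import Data.Fin.Properties using (all?; any?; toℕ-injective; toℕ<n; toℕ-fromℕ<)
open import Data.Fin.Subset using (Subset; _∈_; _∉_; _⊆_; _∩_; _∪_; _─_; _-_; ∣_∣; ∁)
open import Data.Fin.Subset.Properties
open import Data.Nat using (ℕ; zero; suc; _≤_; _<_; _+_; _*_; _∸_; z≤n; s≤s; s≤s⁻¹; _≤?_; _<?_; NonZero)
open import Data.Nat.DivMod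
  using ( _%_; _mod_; m%n<n; m%n≤m; m<n⇒m%n≡m; m%n%n≡m%n; n%n≡0; [m+n]%n≡m%n; m≤n⇒[n∸m]%m≡n%m
        ; %-distribˡ-+; %-congˡ)
open import Data.Nat.Properties
open import Data.Product using (Σ; ∃; _×_; _,_; proj₁; proj₂; curry)
open import Data.Sum using (_⊎_; inj₁; inj₂)
open import Data.Vec using (lookup; tabulate; _∷_; []; here; there)
open import Data.Vec.Properties using (lookup∘tabulate; []=⇒lookup; lookup⇒[]=)
open import Function using (_∘_; flip; case_of_)
open import Function.Bundles using (_⇔_; Equivalence)
open import Function.Definitions using (Injective)
open import Relation.Binary.PropositionalEquality
  using (_≡_; _≢_; refl; sym; trans; cong; cong₂; subst; subst₂; module ≡-Reasoning)
open import Relation.Nullary using (¬_; Dec; yes; no; does)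
open import Relation.Nullary.Decidable using (¬?; _×-dec_; _→-dec_; dec-true; dec-false)
open import Relation.Unary using (Pred; Decidable)

isOdd : ℕ → Bool
isOdd zero    = false
isOdd (suc n) = not (isOdd n)

isOdd-+ : ∀ m n → isOdd (m + n) ≡ isOdd m xor isOdd n
isOdd-+ zero    n = refl
isOdd-+ (suc m) n = trans (cong not (isOdd-+ m n)) (not-distribˡ-xor (isOdd m) (isOdd n))

isOdd-double : ∀ t → isOdd (t + t) ≡ false
isOdd-double t = trans (isOdd-+ t t) (xor-same (isOdd t))

Odd⇒isOdd : ∀ {m} → Odd m → isOdd m ≡ true
Odd⇒isOdd (t , refl) = cong not (isOdd-double t)

[1+m]%n≡[1+m%n]%n : ∀ i L .{{_ : NonZero L}} → suc i % L ≡ suc (i % L) % L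
[1+m]%n≡[1+m%n]%n i L = begin
  suc i % L                ≡⟨ %-distribˡ-+ 1 i L ⟩
  (1 % L + i % L) % L      ≡⟨ cong (λ r → (1 % L + r) % L) (m%n%n≡m%n i L) ⟨
  (1 % L + i % L % L) % L  ≡⟨ %-distribˡ-+ 1 (i % L) L ⟨
  suc (i % L) % L          ∎
  where open ≡-Reasoning

%-cyclic-successor : ∀ i L .{{_ : NonZero L}} → suc (i % L) ≡ suc i % L ⊎ (suc (i % L) ≡ L × suc i % L ≡ 0)
%-cyclic-successor i L with m≤n⇒m<n∨m≡n (m%n<n i L)
... | inj₁ i%L+1<L = inj₁ (sym (trans ([1+m]%n≡[1+m%n]%n i L) (m<n⇒m%n≡m i%L+1<L)))
... | inj₂ i%L+1≡L = inj₂ (i%L+1≡L , trans ([1+m]%n≡[1+m%n]%n i L) (trans (%-congˡ i%L+1≡L) (n%n≡0 L)))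

m≢o∧m<o+n⇒m%n≢o : ∀ {i r L} .{{_ : NonZero L}} → i ≢ r → i < r + L → i % L ≢ r
m≢o∧m<o+n⇒m%n≢o {i} {r} {L} i≢r i<r+L with i <? L
... | yes i<L = subst (_≢ r) (sym (m<n⇒m%n≡m i<L)) i≢r
... | no  i≮L = <⇒≢ (begin-strict
  i % L        ≡⟨ m≤n⇒[n∸m]%m≡n%m L≤i ⟨
  (i ∸ L) % L  ≤⟨ m%n≤m (i ∸ L) L ⟩
  i ∸ L        <⟨ ∸-monoˡ-< i<r+L L≤i ⟩
  r + L ∸ L    ≡⟨ m+n∸n≡m r L ⟩
  r            ∎)
  where
  open ≤-Reasoning
  L≤i : L ≤ i
  L≤i = ≮⇒≥ i≮L

subsetOf : ∀ {n ℓ} {P : Pred (Fin n) ℓ} → Decidable P → Subset n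
subsetOf P? = tabulate (does ∘ P?)

∈-subsetOf⁺ : ∀ {n ℓ} {P : Pred (Fin n) ℓ} (P? : Decidable P) {v} → P v → v ∈ subsetOf P?
∈-subsetOf⁺ P? {v} pv = lookup⇒[]= v _ (trans (lookup∘tabulate (does ∘ P?) v) (dec-true (P? v) pv))

∈-subsetOf⁻ : ∀ {n ℓ} {P : Pred (Fin n) ℓ} (P? : Decidable P) {v} → v ∈ subsetOf P? → P v
∈-subsetOf⁻ P? {v} v∈ with P? v | trans (sym (lookup∘tabulate (does ∘ P?) v)) ([]=⇒lookup v∈)
... | yes pv | _ = pv
... | no _   | ()

x∈p─q⇒x∉q : ∀ {n} {p q : Subset n} {x} → x ∈ p ─ q → x ∉ q
x∈p─q⇒x∉q {p = true  ∷ p} {false ∷ q} here      ()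
x∈p─q⇒x∉q {p = true  ∷ p} {true  ∷ q} {F.zero} ()
x∈p─q⇒x∉q {p = false ∷ p} {false ∷ q} {F.zero} ()
x∈p─q⇒x∉q {p = false ∷ p} {true  ∷ q} {F.zero} ()
x∈p─q⇒x∉q {p = _     ∷ p} {_     ∷ q} (there x∈) (there x∈q) = x∈p─q⇒x∉q x∈ x∈q

x∉p∪q : ∀ {n} {p q : Subset n} {x} → x ∉ p → x ∉ q → x ∉ p ∪ q
x∉p∪q {p = p} {q} x∉p x∉q x∈ with x∈p∪q⁻ p q x∈
... | inj₁ x∈p = x∉p x∈p
... | inj₂ x∈q = x∉q x∈q

∣p∪q∣≤∣p∣+∣q∣ : ∀ {n} (p q : Subset n) → ∣ p ∪ q ∣ ≤ ∣ p ∣ + ∣ q ∣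
∣p∪q∣≤∣p∣+∣q∣ []          []          = z≤n
∣p∪q∣≤∣p∣+∣q∣ (true  ∷ p) (true  ∷ q) = s≤s (≤-trans (∣p∪q∣≤∣p∣+∣q∣ p q) (+-monoʳ-≤ ∣ p ∣ (n≤1+n ∣ q ∣)))
∣p∪q∣≤∣p∣+∣q∣ (true  ∷ p) (false ∷ q) = s≤s (∣p∪q∣≤∣p∣+∣q∣ p q)
∣p∪q∣≤∣p∣+∣q∣ (false ∷ p) (true  ∷ q) =
  ≤-trans (s≤s (∣p∪q∣≤∣p∣+∣q∣ p q)) (≤-reflexive (sym (+-suc ∣ p ∣ ∣ q ∣)))
∣p∪q∣≤∣p∣+∣q∣ (false ∷ p) (false ∷ q) = ∣p∪q∣≤∣p∣+∣q∣ p q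

injective⇒≤∣_∣ : ∀ {n} (p : Subset n) (h : ℕ → Fin n) d → (∀ i → i < d → h i ∈ p) →
  (∀ i j → i < d → j < d → h i ≡ h j → i ≡ j) → d ≤ ∣ p ∣
injective⇒≤∣ p ∣ h zero    _    _     = z≤n
injective⇒≤∣ p ∣ h (suc d) h∈p h-inj =
  ≤-trans (s≤s (injective⇒≤∣ p - h d ∣ h d h∈p-hd λ i j i<d j<d →
                  h-inj i j (m<n⇒m<1+n i<d) (m<n⇒m<1+n j<d)))
          (x∈p⇒∣p-x∣<∣p∣ (h∈p d ≤-refl))
  where
  h∈p-hd : ∀ i → i < d → h i ∈ p - h d
  h∈p-hd i i<d = x∈p∧x≢y⇒x∈p-y (h∈p i (m<n⇒m<1+n i<d)) (<⇒≢ i<d ∘ h-inj i d (m<n⇒m<1+n i<d) ≤-refl)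

ProperOutside : ∀ {n} → Graph n → Subset n → (Fin n → Bool) → Set
ProperOutside G Z c = ∀ u v → u ∉ Z → v ∉ Z → Edge G u v → c u ≢ c v

module _ {n} (G : Graph n) where

  properOutside? : ∀ Z c → Dec (ProperOutside G Z c)
  properOutside? Z c = all? λ u → all? λ v →
    ¬? (u ∈? Z) →-dec ¬? (v ∈? Z) →-dec (adj G u v B.≟ true) →-dec ¬? (c u B.≟ c v)

  IsOCT? : ∀ Z → Dec (IsOCT G Z)
  IsOCT? Z with anySubset? (properOutside? Z ∘ lookup)
  ... | yes (s , proper) = yes (lookup s , proper)
  ... | no ¬proper       = no λ (c , proper) → ¬proper (tabulate c , λ u v u∉Z v∉Z uv →
    proper u v u∉Z v∉Z uv ∘ λ eq → trans (sym (lookup∘tabulate c u)) (trans eq (lookup∘tabulate c v)))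

  minimalOCT-⊆ : ∀ {Z} → IsOCT G Z → Σ (Subset n) λ Z′ → Z′ ⊆ Z × IsMinimalOCT G Z′
  minimalOCT-⊆ {Z} = go Z (suc ∣ Z ∣) ≤-refl
    where
    go : ∀ Z m → ∣ Z ∣ < m → IsOCT G Z → Σ (Subset n) λ Z′ → Z′ ⊆ Z × IsMinimalOCT G Z′
    go Z (suc m) (s≤s ∣Z∣≤m) oct with anySubset? (λ Z′ → (Z′ ⊂? Z) ×-dec IsOCT? Z′)
    ... | yes (Z′ , Z′⊂Z , oct′) =
      let Z″ , Z″⊆Z′ , minimal = go Z′ m (≤-trans (p⊂q⇒∣p∣<∣q∣ Z′⊂Z) ∣Z∣≤m) oct′
      in  Z″ , (λ v∈Z″ → p⊂q⇒p⊆q Z′⊂Z (Z″⊆Z′ v∈Z″)) , minimal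
    ... | no ∄smaller = Z , (λ v∈Z → v∈Z) , oct , λ Z′ Z′⊂Z oct′ → ∄smaller (Z′ , Z′⊂Z , oct′)

  minimalOCT-avoiding : ∀ (P : Subset n) c → (∀ u v → u ∈ P → v ∈ P → Edge G u v → c u ≢ c v) →
    Σ (Subset n) λ Z → IsMinimalOCT G Z × (∀ {v} → v ∈ P → v ∉ Z)
  minimalOCT-avoiding P c proper =
    let Z , Z⊆∁P , minimal = minimalOCT-⊆ (c , λ u v u∉∁P v∉∁P → proper u v (x∉∁p⇒x∈p u∉∁P) (x∉∁p⇒x∈p v∉∁P))
    in  Z , minimal , λ v∈P v∈Z → x∈p⇒x∉∁p v∈P (Z⊆∁P v∈Z)

module _ {n} (G : Graph n) (w : ℕ → Fin n) (w-edge : ∀ i → Edge G (w i) (w (suc i))) where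
  open ≡-Reasoning

  colour-changes-along-walk : ∀ {Z c} → ProperOutside G Z c → ∀ a d → (∀ i → i ≤ d → w (a + i) ∉ Z) →
    c (w (a + d)) xor c (w a) ≡ isOdd d
  colour-changes-along-walk {c = c} _ a zero _ rewrite +-identityʳ a = xor-same (c (w a))
  colour-changes-along-walk {Z} {c} proper a (suc d) avoid = begin
    c (w (a + suc d)) xor c (w a)    ≡⟨ cong (λ i → c (w i) xor c (w a)) (+-suc a d) ⟩
    c (w (suc (a + d))) xor c (w a)  ≡⟨ cong (_xor c (w a)) (¬-not (colour-flips ∘ sym)) ⟩
    not (c (w (a + d))) xor c (w a)  ≡⟨ not-distribˡ-xor (c (w (a + d))) (c (w a)) ⟨
    not (c (w (a + d)) xor c (w a))  ≡⟨ cong not (colour-changes-along-walk proper a d λ i i≤d →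
                                                    avoid i (m≤n⇒m≤1+n i≤d)) ⟩
    not (isOdd d)                    ∎
    where
    colour-flips : c (w (a + d)) ≢ c (w (suc (a + d)))
    colour-flips = proper _ _ (avoid d (n≤1+n d))
      (subst (λ i → w i ∉ Z) (+-suc a d) (avoid (suc d) ≤-refl)) (w-edge (a + d))

  constant-along-walk : ∀ {S} {A : Set} (h : Fin n → A) → (∀ u v → u ∉ S → v ∉ S → Edge G u v → h u ≡ h v) →
    ∀ a d → (∀ i → i ≤ d → w (a + i) ∉ S) → h (w (a + d)) ≡ h (w a)
  constant-along-walk h _ a zero _ = cong (h ∘ w) (+-identityʳ a)
  constant-along-walk {S} h h-constant a (suc d) avoid = begin
    h (w (a + suc d))    ≡⟨ cong (h ∘ w) (+-suc a d) ⟩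
    h (w (suc (a + d)))  ≡⟨ h-constant _ _ (avoid d (n≤1+n d))
                              (subst (λ i → w i ∉ S) (+-suc a d) (avoid (suc d) ≤-refl)) (w-edge (a + d)) ⟨
    h (w (a + d))        ≡⟨ constant-along-walk h h-constant a d (λ i i≤d → avoid i (m≤n⇒m≤1+n i≤d)) ⟩
    h (w a)              ∎

module SideSeparation {n} (G : Graph n) (S : Subset n) (side : Fin n → Bool)
  (side-constant : ∀ u v → u ∉ S → v ∉ S → Edge G u v → side u ≡ side v) where

  side≡? : ∀ b v → Dec (side v ≡ b)
  side≡? b v = side v B.≟ b

  X Y : Subset n
  X = S ∪ subsetOf (side≡? false)
  Y = S ∪ subsetOf (side≡? true)

  side-of-X : ∀ {v} → v ∈ X → v ∉ S → side v ≡ false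
  side-of-X v∈X v∉S with x∈p∪q⁻ S _ v∈X
  ... | inj₁ v∈S = ⊥-elim (v∉S v∈S)
  ... | inj₂ v∈ = ∈-subsetOf⁻ (side≡? false) v∈

  side-of-Y : ∀ {v} → v ∈ Y → v ∉ S → side v ≡ true
  side-of-Y v∈Y v∉S with x∈p∪q⁻ S _ v∈Y
  ... | inj₁ v∈S = ⊥-elim (v∉S v∈S)
  ... | inj₂ v∈ = ∈-subsetOf⁻ (side≡? true) v∈

  X∩Y⊆S : X ∩ Y ⊆ S
  X∩Y⊆S {v} v∈X∩Y with x∈p∩q⁻ X Y v∈X∩Y | v ∈? S
  ... | _         | yes v∈S = v∈S
  ... | v∈X , v∈Y | no  v∉S with () ← trans (sym (side-of-X v∈X v∉S)) (side-of-Y v∈Y v∉S)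

  isSeparation : IsSeparation G X Y
  isSeparation = covers , no-edge
    where
    covers : ∀ v → v ∈ X ⊎ v ∈ Y
    covers v with side v in eq
    ... | false = inj₁ (x∈p∪q⁺ (inj₂ (∈-subsetOf⁺ (side≡? false) eq)))
    ... | true  = inj₂ (x∈p∪q⁺ (inj₂ (∈-subsetOf⁺ (side≡? true) eq)))

    no-edge : ∀ u v → u ∈ X ─ Y → v ∈ Y ─ X → ¬ Edge G u v
    no-edge u v u∈X─Y v∈Y─X uv = case false≡true of λ ()
      where
      u∉S : u ∉ S
      u∉S = x∈p─q⇒x∉q u∈X─Y ∘ p⊆p∪q _
      v∉S : v ∉ S
      v∉S = x∈p─q⇒x∉q v∈Y─X ∘ p⊆p∪q _
      false≡true : false ≡ true
      false≡true = trans (sym (side-of-X (p─q⊆p X Y u∈X─Y) u∉S))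
                     (trans (side-constant u v u∉S v∉S uv) (side-of-Y (p─q⊆p Y X v∈Y─X) v∉S))

  ∈X─Y : ∀ {v} → v ∉ S → side v ≡ false → v ∈ X ─ Y
  ∈X─Y {v} v∉S false-side = x∈p∧x∉q⇒x∈p─q v∈X (v∉S ∘ X∩Y⊆S ∘ curry x∈p∩q⁺ v∈X)
    where
    v∈X : v ∈ X
    v∈X = x∈p∪q⁺ (inj₂ (∈-subsetOf⁺ (side≡? false) false-side))

  ∈Y─X : ∀ {v} → v ∉ S → side v ≡ true → v ∈ Y ─ X
  ∈Y─X {v} v∉S true-side = x∈p∧x∉q⇒x∈p─q v∈Y (v∉S ∘ X∩Y⊆S ∘ flip (curry x∈p∩q⁺) v∈Y)
    where
    v∈Y : v ∈ Y
    v∈Y = x∈p∪q⁺ (inj₂ (∈-subsetOf⁺ (side≡? true) true-side))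

alternating : ℕ → ℕ → Bool
alternating r m = isOdd m xor does (m ≤? r)

alternating-suc : ∀ {r m} → m ≢ r → alternating r (suc m) ≡ not (alternating r m)
alternating-suc {r} {m} m≢r = begin
  not (isOdd m) xor does (suc m ≤? r)  ≡⟨ cong (not (isOdd m) xor_) same-side ⟩
  not (isOdd m) xor does (m ≤? r)      ≡⟨ not-distribˡ-xor (isOdd m) (does (m ≤? r)) ⟨
  not (alternating r m)                ∎
  where
  open ≡-Reasoning
  same-side : does (suc m ≤? r) ≡ does (m ≤? r)
  same-side with m ≤? r
  ... | yes m≤r = trans (dec-true (suc m ≤? r) (≤∧≢⇒< m≤r m≢r)) (sym (dec-true (m ≤? r) m≤r))
  ... | no  m≰r = trans (dec-false (suc m ≤? r) (m≰r ∘ <⇒≤)) (sym (dec-false (m ≤? r) m≰r))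

alternating-proper : ∀ {L} → Odd L → (p i j : Fin L) → i ≢ p → j ≢ p → CycNext i j →
  alternating (toℕ p) (toℕ i) ≢ alternating (toℕ p) (toℕ j)
alternating-proper _ p i j i≢p _ (inj₁ i+1≡j) eq =
  not-¬ refl (trans eq (trans (cong (alternating (toℕ p)) (sym i+1≡j))
                               (alternating-suc (i≢p ∘ toℕ-injective))))
alternating-proper (t , refl) p i j i≢p _ (inj₂ (i+1≡L , j≡0)) eq =
  case trans (sym colour-i) (trans eq colour-j) of λ ()
  where
  i≡2t : toℕ i ≡ t + t
  i≡2t = suc-injective i+1≡L
  i≰p : ¬ toℕ i ≤ toℕ p
  i≰p i≤p = i≢p (toℕ-injective (≤-antisym i≤p (subst (toℕ p ≤_) (sym i≡2t) (s≤s⁻¹ (toℕ<n p)))))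
  colour-i : alternating (toℕ p) (toℕ i) ≡ false
  colour-i = cong₂ _xor_ (trans (cong isOdd i≡2t) (isOdd-double t)) (dec-false (toℕ i ≤? toℕ p) i≰p)
  colour-j : alternating (toℕ p) (toℕ j) ≡ true
  colour-j = cong₂ _xor_ (cong isOdd j≡0) (dec-true (toℕ j ≤? toℕ p) (subst (_≤ toℕ p) (sym j≡0) z≤n))

module InducedCycle {n M} (G : Graph n) (f : Fin (suc M) → Fin n) (f-injective : Injective _≡_ _≡_ f)
  (f-adj : ∀ i j → Edge G (f i) (f j) ⇔ CycAdj i j) where

  extendColouring : (Fin (suc M) → Bool) → Fin n → Bool
  extendColouring κ v with any? (λ j → f j F.≟ v)
  ... | yes (j , _) = κ j
  ... | no  _       = false

  extendColouring-f : ∀ κ j → extendColouring κ (f j) ≡ κ j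
  extendColouring-f κ j with any? (λ j′ → f j′ F.≟ f j)
  ... | yes (j′ , fj′≡fj) = cong κ (f-injective fj′≡fj)
  ... | no  ∄j            = ⊥-elim (∄j (j , refl))

  on-cycle-except? : ∀ p v → Dec (∃ λ j → j ≢ p × f j ≡ v)
  on-cycle-except? p v = any? λ j → ¬? (j F.≟ p) ×-dec (f j F.≟ v)

  cycle-without : Fin (suc M) → Subset n
  cycle-without p = subsetOf (on-cycle-except? p)

  minimalOCT-meeting-cycle-only-at : Odd (suc M) → ∀ p →
    Σ (Subset n) λ Z → IsMinimalOCT G Z × (∀ j → j ≢ p → f j ∉ Z)
  minimalOCT-meeting-cycle-only-at odd p =
    let Z , minimal , avoids = minimalOCT-avoiding G (cycle-without p) (extendColouring κ) proper
    in  Z , minimal , λ j j≢p → avoids (∈-subsetOf⁺ (on-cycle-except? p) (j , j≢p , refl))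
    where
    κ : Fin (suc M) → Bool
    κ = alternating (toℕ p) ∘ toℕ
    proper : ∀ u v → u ∈ cycle-without p → v ∈ cycle-without p → Edge G u v →
      extendColouring κ u ≢ extendColouring κ v
    proper u v u∈ v∈ uv with ∈-subsetOf⁻ (on-cycle-except? p) u∈ | ∈-subsetOf⁻ (on-cycle-except? p) v∈
    ... | i , i≢p , refl | j , j≢p , refl rewrite extendColouring-f κ i | extendColouring-f κ j
      with Equivalence.to (f-adj i j) uv
    ... | inj₁ i→j = alternating-proper odd p i j i≢p j≢p i→j
    ... | inj₂ j→i = alternating-proper odd p j i j≢p i≢p j→i ∘ sym

  walk : ℕ → Fin n
  walk i = f (i mod suc M)

  toℕ-mod : ∀ i → toℕ (i mod suc M) ≡ i % suc M
  toℕ-mod i = toℕ-fromℕ< (m%n<n i (suc M))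

  walk-edge : ∀ i → Edge G (walk i) (walk (suc i))
  walk-edge i = Equivalence.from (f-adj _ _) (inj₁ (subst₂ (λ a b → suc a ≡ b ⊎ (suc a ≡ suc M × b ≡ 0))
    (sym (toℕ-mod i)) (sym (toℕ-mod (suc i))) (%-cyclic-successor i (suc M))))

  walk-injective : ∀ {i j} → i < suc M → j < suc M → walk i ≡ walk j → i ≡ j
  walk-injective {i} {j} i<L j<L eq = begin
    i                ≡⟨ m<n⇒m%n≡m i<L ⟨
    i % suc M        ≡⟨ toℕ-mod i ⟨
    toℕ (i mod suc M) ≡⟨ cong toℕ (f-injective eq) ⟩
    toℕ (j mod suc M) ≡⟨ toℕ-mod j ⟩
    j % suc M        ≡⟨ m<n⇒m%n≡m j<L ⟩
    j                ∎
    where open ≡-Reasoning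

  walk-periodic : ∀ i → walk (i + suc M) ≡ walk i
  walk-periodic i = cong f (toℕ-injective
    (trans (toℕ-mod (i + suc M)) (trans ([m+n]%n≡m%n i (suc M)) (sym (toℕ-mod i)))))

  walk-avoids : ∀ {Z} p → (∀ j → j ≢ p → f j ∉ Z) → ∀ i → i ≢ toℕ p → i < toℕ p + suc M → walk i ∉ Z
  walk-avoids p avoids i i≢p i<p+L = avoids (i mod suc M) λ eq →
    m≢o∧m<o+n⇒m%n≢o i≢p i<p+L (trans (sym (toℕ-mod i)) (cong toℕ eq))

  walk-segment-≤∣_∣ : ∀ P a d → a + d ≤ suc M → (∀ j → j < d → walk (a + j) ∈ P) → d ≤ ∣ P ∣
  walk-segment-≤∣ P ∣ a d a+d≤L segment⊆P = injective⇒≤∣ P ∣ (walk ∘ (a +_)) d segment⊆P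
    λ i j i<d j<d eq → +-cancelˡ-≡ a i j (walk-injective (in-period i<d) (in-period j<d) eq)
    where
    in-period : ∀ {i} → i < d → a + i < suc M
    in-period i<d = <-≤-trans (+-monoʳ-< a i<d) a+d≤L

  module OppositeArcs (odd : Odd (suc M)) (p : Fin (suc M)) (1<p : 1 < toℕ p) (p<M : toℕ p < M)
    {Z₁ Z₂ : Subset n} (oct₁ : IsOCT G Z₁) (oct₂ : IsOCT G Z₂)
    (avoids₁ : ∀ j → j ≢ F.zero → f j ∉ Z₁) (avoids₂ : ∀ j → j ≢ p → f j ∉ Z₂) where

    S : Subset n
    S = Z₁ ∪ Z₂

    private
      r : ℕ
      r = toℕ p
      c₁ c₂ : Fin n → Bool
      c₁ = proj₁ oct₁
      c₂ = proj₁ oct₂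
      proper₁ : ProperOutside G Z₁ c₁
      proper₁ = proj₂ oct₁
      proper₂ : ProperOutside G Z₂ c₂
      proper₂ = proj₂ oct₂

      walk-avoids-S : ∀ i → i ≢ 0 → i ≢ r → i < suc M → walk i ∉ S
      walk-avoids-S i i≢0 i≢r i<L = x∉p∪q (walk-avoids F.zero avoids₁ i i≢0 i<L)
                                         (walk-avoids p avoids₂ i i≢r (≤-trans i<L (m≤n+m (suc M) r)))

      r+[L∸r]≡L : r + (suc M ∸ r) ≡ suc M
      r+[L∸r]≡L = m+[n∸m]≡n (<⇒≤ (<-trans p<M (n<1+n M)))

      returns-before-p : ∀ {i} → i ≤ suc M ∸ r → suc r + i < r + suc M
      returns-before-p {i} i≤L∸r = begin-strict
        suc r + i              ≤⟨ +-monoʳ-≤ (suc r) i≤L∸r ⟩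
        suc (r + (suc M ∸ r))  ≡⟨ cong suc r+[L∸r]≡L ⟩
        1 + suc M              <⟨ +-monoˡ-< (suc M) 1<p ⟩
        r + suc M              ∎
        where open ≤-Reasoning

    side : Fin n → Bool
    side v = (c₁ v xor c₂ v) xor (c₁ (walk 1) xor c₂ (walk 1))

    side-constant : ∀ u v → u ∉ S → v ∉ S → Edge G u v → side u ≡ side v
    side-constant u v u∉S v∉S uv = cong (_xor (c₁ (walk 1) xor c₂ (walk 1))) (begin
      c₁ u xor c₂ u              ≡⟨ xor-annihilates-not (c₁ u) (c₂ u) ⟨
      not (c₁ u) xor not (c₂ u)  ≡⟨ cong₂ _xor_ (flips proper₁ (u∉S ∘ p⊆p∪q Z₂) (v∉S ∘ p⊆p∪q Z₂))
                                                (flips proper₂ (u∉S ∘ q⊆p∪q Z₁ Z₂) (v∉S ∘ q⊆p∪q Z₁ Z₂)) ⟩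
      c₁ v xor c₂ v              ∎)
      where
      open ≡-Reasoning
      flips : ∀ {Z c} → ProperOutside G Z c → u ∉ Z → v ∉ Z → not (c u) ≡ c v
      flips proper u∉Z v∉Z = sym (¬-not (proper u v u∉Z v∉Z uv ∘ sym))

    side-after-p : side (walk (suc r)) ≡ true
    side-after-p = begin
      (c₁ x xor c₂ x) xor (c₁ y xor c₂ y)  ≡⟨ xor-interchange (c₁ x) (c₂ x) (c₁ y) (c₂ y) ⟩
      (c₁ x xor c₁ y) xor (c₂ x xor c₂ y)  ≡⟨ cong₂ _xor_ lower-parity
                                                    (trans (xor-comm (c₂ x) (c₂ y)) upper-parity) ⟩
      isOdd r xor isOdd (suc M ∸ r)        ≡⟨ isOdd-+ r (suc M ∸ r) ⟨
      isOdd (r + (suc M ∸ r))              ≡⟨ cong isOdd r+[L∸r]≡L ⟩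
      isOdd (suc M)                        ≡⟨ Odd⇒isOdd odd ⟩
      true                                 ∎
      where
      open ≡-Reasoning
      x y : Fin n
      x = walk (suc r)
      y = walk 1
      lower-parity : c₁ x xor c₁ y ≡ isOdd r
      lower-parity = colour-changes-along-walk G walk walk-edge proper₁ 1 r λ i i≤r →
        walk-avoids F.zero avoids₁ (suc i) (λ ()) (s≤s (≤-<-trans i≤r p<M))
      upper-parity : c₂ y xor c₂ x ≡ isOdd (suc M ∸ r)
      upper-parity = subst (λ z → c₂ z xor c₂ x ≡ isOdd (suc M ∸ r))
        (trans (cong (walk ∘ suc) r+[L∸r]≡L) (walk-periodic 1))
        (colour-changes-along-walk G walk walk-edge proper₂ (suc r) (suc M ∸ r) λ i i≤L∸r →
          walk-avoids p avoids₂ (suc r + i) (>⇒≢ (s≤s (m≤m+n r i))) (returns-before-p i≤L∸r))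

    open SideSeparation G S side side-constant public

    lower-arc⊆X─Y : ∀ i → 0 < i → i < r → walk i ∈ X ─ Y
    lower-arc⊆X─Y (suc i) _ i+1<r = ∈X─Y (avoids i ≤-refl)
      (trans (constant-along-walk G walk walk-edge side side-constant 1 i avoids)
             (xor-same (c₁ (walk 1) xor c₂ (walk 1))))
      where
      avoids : ∀ j → j ≤ i → walk (suc j) ∉ S
      avoids j j≤i = walk-avoids-S (suc j) (λ ()) (<⇒≢ j+1<r) (<-trans j+1<r (<-trans p<M (n<1+n M)))
        where
        j+1<r : suc j < r
        j+1<r = ≤-<-trans (s≤s j≤i) i+1<r

    upper-arc⊆Y─X : ∀ i → r < i → i < suc M → walk i ∈ Y ─ X
    upper-arc⊆Y─X i r<i i<L with e , refl ← m≤n⇒∃[o]m+o≡n r<i = ∈Y─X (avoids e ≤-refl)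
      (trans (constant-along-walk G walk walk-edge side side-constant (suc r) e avoids) side-after-p)
      where
      avoids : ∀ j → j ≤ e → walk (suc r + j) ∉ S
      avoids j j≤e = walk-avoids-S (suc r + j) (λ ()) (>⇒≢ (s≤s (m≤m+n r j)))
                                   (≤-<-trans (+-monoʳ-≤ (suc r) j≤e) i<L)

  module _ (odd : Odd (suc M)) {q : ℕ} (1≤q : 1 ≤ q) (2q+2≤L : 2 * q + 2 ≤ suc M) where

    private
      2+q+q≤L : 2 + q + q ≤ suc M
      2+q+q≤L = subst (_≤ suc M) (trans (+-comm (2 * q) 2) (cong (λ m → 2 + (q + m)) (+-identityʳ q))) 2q+2≤L

      q+1<M : suc q < M
      q+1<M = s≤s⁻¹ (≤-trans (s≤s (s≤s (+-monoˡ-≤ q 1≤q))) 2+q+q≤L)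

      p : Fin (suc M)
      p = fromℕ< (m<n⇒m<1+n q+1<M)

      toℕ-p : toℕ p ≡ suc q
      toℕ-p = toℕ-fromℕ< (m<n⇒m<1+n q+1<M)

    arcs-separation : ∀ {Z₁ Z₂} → IsOCT G Z₁ → IsOCT G Z₂ →
      (∀ j → j ≢ F.zero → f j ∉ Z₁) → (∀ j → j ≢ p → f j ∉ Z₂) →
      Σ (Subset n) λ X → Σ (Subset n) λ Y →
        IsSeparation G X Y × order X Y ≤ ∣ Z₁ ∣ + ∣ Z₂ ∣ × q ≤ ∣ X ─ Y ∣ × q ≤ ∣ Y ─ X ∣
    arcs-separation {Z₁} {Z₂} oct₁ oct₂ avoids₁ avoids₂ =
      X , Y , isSeparation , ≤-trans (p⊆q⇒∣p∣≤∣q∣ X∩Y⊆S) (∣p∪q∣≤∣p∣+∣q∣ Z₁ Z₂) ,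
      walk-segment-≤∣ X ─ Y ∣ 1 q (≤-trans (n≤1+n _) (≤-trans (m≤m+n (2 + q) q) 2+q+q≤L)) lower ,
      walk-segment-≤∣ Y ─ X ∣ (2 + q) q 2+q+q≤L upper
      where
      open OppositeArcs odd p (subst (1 <_) (sym toℕ-p) (s≤s 1≤q)) (subst (_< M) (sym toℕ-p) q+1<M)
                        oct₁ oct₂ avoids₁ avoids₂
      lower : ∀ j → j < q → walk (suc j) ∈ X ─ Y
      lower j j<q = lower-arc⊆X─Y (suc j) (s≤s z≤n) (subst (suc j <_) (sym toℕ-p) (s≤s j<q))
      upper : ∀ j → j < q → walk (2 + q + j) ∈ Y ─ X
      upper j j<q = upper-arc⊆Y─X (2 + q + j) (subst (_< 2 + q + j) (sym toℕ-p) (s≤s (s≤s (m≤m+n q j))))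
        (<-≤-trans (+-monoʳ-< (2 + q) j<q) 2+q+q≤L)

    large-minimalOCT : ∀ {k} → Unbreakable q (2 * k) G → Σ (Subset n) λ Z → IsMinimalOCT G Z × k ≤ ∣ Z ∣
    large-minimalOCT {k} unbreakable
      with Z₁ , minimal₁ , avoids₁ ← minimalOCT-meeting-cycle-only-at odd F.zero
      with Z₂ , minimal₂ , avoids₂ ← minimalOCT-meeting-cycle-only-at odd p
      with k ≤? ∣ Z₁ ∣ | k ≤? ∣ Z₂ ∣
    ... | yes k≤∣Z₁∣ | _         = Z₁ , minimal₁ , k≤∣Z₁∣
    ... | no  _      | yes k≤∣Z₂∣ = Z₂ , minimal₂ , k≤∣Z₂∣
    ... | no  k≰∣Z₁∣ | no k≰∣Z₂∣ =
      let X , Y , separation , order≤ , q≤∣X─Y∣ , q≤∣Y─X∣ =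
            arcs-separation (proj₁ minimal₁) (proj₁ minimal₂) avoids₁ avoids₂
      in  ⊥-elim (unbreakable X Y separation (≤-trans order≤ ∣Z₁∣+∣Z₂∣≤2k) q≤∣X─Y∣ q≤∣Y─X∣)
      where
      ∣Z₁∣+∣Z₂∣≤2k : ∣ Z₁ ∣ + ∣ Z₂ ∣ ≤ 2 * k
      ∣Z₁∣+∣Z₂∣≤2k = ≤-trans (+-mono-≤ (<⇒≤ (≰⇒> k≰∣Z₁∣)) (<⇒≤ (≰⇒> k≰∣Z₂∣)))
                             (≤-reflexive (cong (k +_) (sym (+-identityʳ k))))

lemma16 : (q k : ℕ) → 1 ≤ q → 1 ≤ k → (n : ℕ) → (G : Graph n) →
    Unbreakable q (2 * k) G →
    (Σ ℕ λ L → 2 * q + 2 ≤ L × InducedOddCycle G L) →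
    Σ (Subset n) λ Z → IsMinimalOCT G Z × k ≤ ∣ Z ∣
lemma16 q k 1≤q _ n G unbreakable (_ , 2q+2≤L , odd@(_ , refl) , _ , f , f-injective , f-adj) =
  InducedCycle.large-minimalOCT G f f-injective f-adj odd 1≤q 2q+2≤L unbreakable
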